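{- Let $G$ be a bridgeless cubic graph, let $M$ be a perfect matching of $G$, and let $A,B,C,D$ be four pairwise disjoint $M$-balanced matchings satisfying: (i) every odd cycle of $G\setminus M$ has, for each of the four sets $A,B,C,D$, exactly one vertex incident with an edge of that set, and at least two of the (edge-disjoint) paths into which these four vertices divide the cycle have odd length; (ii) for every even cycle of $G\setminus M$, at least two of the sets $A,B,C,D$ have no edge incident to a vertex of the cycle. Then $\tau(G)\le 5$.
   Context: For a bridgeless cubic graph $G$, $\tau(G)$ is the minimum number of perfect matchings of $G$ whose union is $E(G)$. Given a perfect matching $M$ of $G$, a set $A\subseteq E(G)$ is an $M$-balanced matching if there is a perfect matching $M'$ of $G$ with $A=M\cap M'$. The graph $G\setminus M$ obtained by deleting the edges of $M$ is a $2$-factor, i.e. a disjoint union of cycles. -}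

module Defs where

open import Data.Nat using (ℕ; zero; suc; _+_; _∸_; _≤_; NonZero)
open import Data.Nat.DivMod using (_%_; m%n<n)
open import Data.Fin using (Fin; toℕ; fromℕ<)
open import Data.Fin.Subset using (Subset; _∈_; _∉_)
open import Data.Product using (Σ; ∃; ∃-syntax; _×_; _,_; proj₁; proj₂)
open import Data.Sum using (_⊎_)
open import Data.Empty using (⊥)
open import Relation.Nullary using (¬_)
open import Relation.Binary.PropositionalEquality using (_≡_; _≢_)
open import Function.Definitions using (Injective)

record Graph : Set where
  field
    n        : ℕ
    m        : ℕ
    ends     : Fin m → Fin n × Fin n
    loopless : ∀ e → proj₁ (ends e) ≢ proj₂ (ends e)

module _ (G : Graph) where
  open Graph G

  Vertex : Set
  Vertex = Fin n

  Edge : Set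
  Edge = Fin m

  EdgeSet : Set
  EdgeSet = Subset m

  Incident : Vertex → Edge → Set
  Incident v e = (proj₁ (ends e) ≡ v) ⊎ (proj₂ (ends e) ≡ v)

  Joins : Edge → Vertex → Vertex → Set
  Joins e u w = (ends e ≡ (u , w)) ⊎ (ends e ≡ (w , u))

  Cubic : Set
  Cubic = ∀ v → ∃[ e₁ ] ∃[ e₂ ] ∃[ e₃ ]
            (Incident v e₁ × Incident v e₂ × Incident v e₃ ×
             e₁ ≢ e₂ × e₁ ≢ e₃ × e₂ ≢ e₃ ×
             (∀ f → Incident v f → (f ≡ e₁) ⊎ (f ≡ e₂) ⊎ (f ≡ e₃)))

  data ConnectedWithout (e : Edge) : Vertex → Vertex → Set where
    here : ∀ {u} → ConnectedWithout e u u
    step : ∀ {u v w} (f : Edge) → f ≢ e → Joins f u v →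
           ConnectedWithout e v w → ConnectedWithout e u w

  IsBridge : Edge → Set
  IsBridge e = ¬ ConnectedWithout e (proj₁ (ends e)) (proj₂ (ends e))

  Bridgeless : Set
  Bridgeless = ∀ e → ¬ IsBridge e

  IsPerfectMatching : EdgeSet → Set
  IsPerfectMatching M = ∀ v → ∃[ e ] (e ∈ M × Incident v e ×
                          (∀ f → f ∈ M → Incident v f → f ≡ e))

  PerfectMatching : Set
  PerfectMatching = Σ EdgeSet IsPerfectMatching

  τ≤ : ℕ → Set
  τ≤ k = ∃[ j ] (j ≤ k × Σ (Fin j → PerfectMatching) λ F →
            ∀ e → ∃[ i ] (e ∈ proj₁ (F i)))

  IsBalanced : EdgeSet → EdgeSet → Set
  IsBalanced M A = ∃[ M' ] (IsPerfectMatching M' ×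
                     (∀ e → (e ∈ A → e ∈ M × e ∈ M') × (e ∈ M × e ∈ M' → e ∈ A)))

  next : ∀ {k} → Fin (suc k) → Fin (suc k)
  next {k} i = fromℕ< (m%n<n (suc (toℕ i)) (suc k))

  record CycleOf (M : EdgeSet) : Set where
    field
      k       : ℕ
      vtx     : Fin (suc k) → Vertex
      edg     : Fin (suc k) → Edge
      vtx-inj : Injective _≡_ _≡_ vtx
      edg-inj : Injective _≡_ _≡_ edg
      edg∉M   : ∀ i → edg i ∉ M
      joins   : ∀ i → Joins (edg i) (vtx i) (vtx (next i))

  len : ∀ {M} → CycleOf M → ℕ
  len C = suc (CycleOf.k C)

  Touches : EdgeSet → Vertex → Set
  Touches X v = ∃[ e ] (e ∈ X × Incident v e)

dist : ∀ {k} → Fin (suc k) → Fin (suc k) → ℕ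
dist {k} i j = (toℕ j + suc k ∸ toℕ i) % suc k

Odd : ℕ → Set
Odd x = x % 2 ≡ 1

Even : ℕ → Set
Even x = x % 2 ≡ 0

-- Given four positions p on a cycle, the path starting at p a (going forward to
-- the next of the four marked positions) has odd length.
OddPathFrom : ∀ {k} → (Fin 4 → Fin (suc k)) → Fin 4 → Set
OddPathFrom p a = ∃[ c ] (p c ≢ p a ×
                    (∀ c' → p c' ≢ p a → dist (p a) (p c) ≤ dist (p a) (p c')) ×
                    Odd (dist (p a) (p c)))

module _ (G : Graph) (M : EdgeSet G) (X : Fin 4 → EdgeSet G) where
  OddCycleCondition : Set
  OddCycleCondition = (C : CycleOf G M) → Odd (len G C) →
    let open CycleOf C in
    Σ (Fin 4 → Fin (suc k)) λ p →
      (∀ a → Touches G (X a) (vtx (p a)) × (∀ j → Touches G (X a) (vtx j) → j ≡ p a)) ×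
      ∃[ a ] ∃[ b ] (p a ≢ p b × OddPathFrom p a × OddPathFrom p b)

  EvenCycleCondition : Set
  EvenCycleCondition = (C : CycleOf G M) → Even (len G C) →
    let open CycleOf C in
    ∃[ a ] ∃[ b ] (a ≢ b ×
      (∀ i → ¬ Touches G (X a) (vtx i)) × (∀ i → ¬ Touches G (X b) (vtx i)))

module Submission where

open import Defs
open import Data.Fin using (Fin)
open import Data.Fin.Subset using (_∈_)
open import Relation.Binary.PropositionalEquality using (_≢_)
open import Relation.Nullary using (¬_)
open import Data.Product using (_×_)

open import Data.Bool using (Bool; true; false; if_then_else_)
open import Data.Empty using (⊥; ⊥-elim)
open import Data.Fin using (zero; suc; toℕ; fromℕ<) renaming (_≟_ to _≟ᶠ_)
open import Data.Fin.Patterns using (0F)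
open import Data.Fin.Properties using (toℕ<n; toℕ-injective; toℕ-fromℕ<; pigeonhole; any?)
open import Data.Fin.Subset using (Subset; _∉_)
open import Data.Fin.Subset.Properties using (_∈?_)
open import Data.Maybe using (Maybe; just; nothing) renaming (map to mapᵐ)
open import Data.Nat using (ℕ; zero; suc; _+_; _∸_; _≤_; _<_; z≤n; s≤s; NonZero)
open import Data.Nat.DivMod using (_%_; m%n<n; m%n%n≡m%n; [m+n]%n≡m%n; m<n⇒m%n≡m; %-distribˡ-+; n%n≡0)
open import Data.Nat.Induction using (<-rec)
open import Data.Nat.Properties using (_≤?_; _<?_; anyUpTo?; +-commutativeSemigroup; +-assoc; +-comm;
  +-cancelʳ-<; +-mono-<; +-monoʳ-<; +-∸-assoc; 0≢1+n; <-cmp; <-irrefl; <-trans; <-≤-trans; <⇒≤; <⇒≱;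
  m+[n∸m]≡n; m+n≡0⇒m≡0; m∸n+n≡m; m∸n≡0⇒m≤n; m∸n≤m; m≤m+n; m≤n+m; n<1+n; ≤-<-trans; ≤-antisym;
  ≤-pred; ≤-refl; ≤-trans; ≮⇒≥; ≰⇒>)
open import Algebra.Properties.CommutativeSemigroup +-commutativeSemigroup using (xy∙z≈y∙xz; xy∙z≈xz∙y)
open import Data.Product using (∃-syntax; _,_; proj₁; proj₂; uncurry)
open import Data.Sum using (_⊎_; inj₁; inj₂; [_,_]; [_,_]′)
open import Data.Vec using (tabulate)
open import Data.Vec.Properties using (lookup∘tabulate; []=⇒lookup; lookup⇒[]=)
open import Function using (id; _∘_)
open import Function.Bundles using (_⇔_; mk⇔; Equivalence)
open import Function.Definitions using (Injective)
open import Relation.Binary.Definitions using (tri<; tri≈; tri>)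
open import Relation.Binary.PropositionalEquality using (_≡_; _≗_; refl; sym; trans; cong; cong₂; subst; subst₂; ≢-sym; module ≡-Reasoning)
open import Relation.Nullary using (Dec; yes; no; does)
open import Relation.Nullary.Decidable using (¬?; _×-dec_; _⊎-dec_; dec-true; dec-false; does-⇔)

open ≡-Reasoning
open Equivalence using (to; from)

-- Let M a (a : Fin 4) be perfect matchings with X a = M ∩ M a.  We build four
-- perfect matchings N a which, together with M, cover E(G).  Edges of M are
-- covered by M; the other edges form the 2-factor G ∖ M.  On a cycle C of
-- G ∖ M, let c be the first colour with X c avoiding C: every other colour a
-- whose X a avoids C takes on C the edges of C outside M c, and all remaining
-- colours keep M a on C.  Such an N a is again a perfect matching.  By (ii)
-- two colours avoid every even cycle, so each of its edges lies in N c or in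
-- the complementary N a.  On an odd cycle every colour keeps M a; as X a
-- meets C in a single vertex, M a alternates along C from it, so an edge in
-- no M a would lie at even offset from all four marks of (i) -- impossible
-- when two of the paths between consecutive marks are odd.

%-absorbˡ : ∀ m n d .{{_ : NonZero d}} → (m % d + n) % d ≡ (m + n) % d
%-absorbˡ m n d = begin
  (m % d + n) % d          ≡⟨ %-distribˡ-+ (m % d) n d ⟩
  (m % d % d + n % d) % d  ≡⟨ cong (λ x → (x + n % d) % d) (m%n%n≡m%n m d) ⟩
  (m % d + n % d) % d      ≡⟨ %-distribˡ-+ m n d ⟨
  (m + n) % d              ∎

%-absorbʳ : ∀ m n d .{{_ : NonZero d}} → (m + n % d) % d ≡ (m + n) % d
%-absorbʳ m n d = begin
  (m + n % d) % d  ≡⟨ cong (_% d) (+-comm m (n % d)) ⟩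
  (n % d + m) % d  ≡⟨ %-absorbˡ n m d ⟩
  (n + m) % d      ≡⟨ cong (_% d) (+-comm n m) ⟩
  (m + n) % d      ∎

-- The cyclic successor of Defs.next; it does not depend on the graph, and
-- `next G` unfolds to exactly this function.
succ : ∀ {k} → Fin (suc k) → Fin (suc k)
succ {k} i = fromℕ< (m%n<n (suc (toℕ i)) (suc k))

module _ {k : ℕ} where
  private
    L : ℕ
    L = suc k

  dist-spec : (i j : Fin L) → (dist i j + toℕ i) % L ≡ toℕ j
  dist-spec i j = begin
    ((toℕ j + L ∸ toℕ i) % L + toℕ i) % L  ≡⟨ %-absorbˡ (toℕ j + L ∸ toℕ i) (toℕ i) L ⟩
    (toℕ j + L ∸ toℕ i + toℕ i) % L        ≡⟨ cong (_% L) (m∸n+n≡m i≤j+L) ⟩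
    (toℕ j + L) % L                        ≡⟨ [m+n]%n≡m%n (toℕ j) L ⟩
    toℕ j % L                              ≡⟨ m<n⇒m%n≡m (toℕ<n j) ⟩
    toℕ j                                  ∎
    where
    i≤j+L : toℕ i ≤ toℕ j + L
    i≤j+L = ≤-trans (<⇒≤ (toℕ<n i)) (m≤n+m L (toℕ j))

  dist-unique : (i j : Fin L) (d : ℕ) → d < L → (d + toℕ i) % L ≡ toℕ j → dist i j ≡ d
  dist-unique i j d d<L offset = begin
    (toℕ j + L ∸ toℕ i) % L                   ≡⟨ cong (_% L) (+-∸-assoc (toℕ j) i≤L) ⟩
    (toℕ j + (L ∸ toℕ i)) % L                 ≡⟨ cong (λ x → (x + (L ∸ toℕ i)) % L) offset ⟨
    ((d + toℕ i) % L + (L ∸ toℕ i)) % L       ≡⟨ %-absorbˡ (d + toℕ i) (L ∸ toℕ i) L ⟩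
    (d + toℕ i + (L ∸ toℕ i)) % L             ≡⟨ cong (_% L) (+-assoc d (toℕ i) (L ∸ toℕ i)) ⟩
    (d + (toℕ i + (L ∸ toℕ i))) % L           ≡⟨ cong (λ x → (d + x) % L) (m+[n∸m]≡n i≤L) ⟩
    (d + L) % L                               ≡⟨ [m+n]%n≡m%n d L ⟩
    d % L                                     ≡⟨ m<n⇒m%n≡m d<L ⟩
    d                                         ∎
    where
    i≤L : toℕ i ≤ L
    i≤L = <⇒≤ (toℕ<n i)

  dist<len : (i j : Fin L) → dist i j < L
  dist<len i j = m%n<n (toℕ j + L ∸ toℕ i) L

  dist-self : (i : Fin L) → dist i i ≡ 0
  dist-self i = dist-unique i i 0 (s≤s z≤n) (m<n⇒m%n≡m (toℕ<n i))

  dist-injective : (p i j : Fin L) → dist p i ≡ dist p j → i ≡ j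
  dist-injective p i j same = toℕ-injective (begin
    toℕ i                    ≡⟨ dist-spec p i ⟨
    (dist p i + toℕ p) % L   ≡⟨ cong (λ d → (d + toℕ p) % L) same ⟩
    (dist p j + toℕ p) % L   ≡⟨ dist-spec p j ⟩
    toℕ j                    ∎)

  dist-succ : (p j : Fin L) → suc (dist p j) < L → dist p (succ j) ≡ suc (dist p j)
  dist-succ p j lt = dist-unique p (succ j) (suc (dist p j)) lt (begin
    (suc (dist p j) + toℕ p) % L     ≡⟨ %-absorbʳ 1 (dist p j + toℕ p) L ⟨
    (1 + (dist p j + toℕ p) % L) % L ≡⟨ cong (λ x → suc x % L) (dist-spec p j) ⟩
    suc (toℕ j) % L                  ≡⟨ toℕ-fromℕ< (m%n<n (suc (toℕ j)) L) ⟨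
    toℕ (succ j)                     ∎)

  dist-compose : (x y z : Fin L) → (dist x y + dist y z + toℕ x) % L ≡ toℕ z
  dist-compose x y z = begin
    (dist x y + dist y z + toℕ x) % L       ≡⟨ cong (_% L) (xy∙z≈y∙xz (dist x y) (dist y z) (toℕ x)) ⟩
    (dist y z + (dist x y + toℕ x)) % L     ≡⟨ %-absorbʳ (dist y z) (dist x y + toℕ x) L ⟨
    (dist y z + (dist x y + toℕ x) % L) % L ≡⟨ cong (λ t → (dist y z + t) % L) (dist-spec x y) ⟩
    (dist y z + toℕ y) % L                  ≡⟨ dist-spec y z ⟩
    toℕ z                                   ∎

  dist-add : (x y z : Fin L) → dist x y + dist y z < L → dist x z ≡ dist x y + dist y z
  dist-add x y z no-wrap = dist-unique x z (dist x y + dist y z) no-wrap (dist-compose x y z)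

  dist-sub : (x y z : Fin L) → dist x y ≤ dist x z → dist y z ≡ dist x z ∸ dist x y
  dist-sub x y z le = dist-unique y z r r<L (begin
    (r + toℕ y) % L                  ≡⟨ cong (λ t → (r + t) % L) (dist-spec x y) ⟨
    (r + (dist x y + toℕ x) % L) % L ≡⟨ %-absorbʳ r (dist x y + toℕ x) L ⟩
    (r + (dist x y + toℕ x)) % L     ≡⟨ cong (_% L) (+-assoc r (dist x y) (toℕ x)) ⟨
    (r + dist x y + toℕ x) % L       ≡⟨ cong (λ t → (t + toℕ x) % L) (m∸n+n≡m le) ⟩
    (dist x z + toℕ x) % L           ≡⟨ dist-spec x z ⟩
    toℕ z                            ∎)
    where
    r : ℕ
    r = dist x z ∸ dist x y
    r<L : r < L
    r<L = ≤-<-trans (m∸n≤m (dist x z) (dist x y)) (dist<len x z)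

  dist-round-trip : (x y : Fin L) → x ≢ y → dist x y + dist y x ≡ L
  dist-round-trip x y x≢y with dist x y + dist y x <? L
  ... | yes no-wrap = ⊥-elim (x≢y (dist-injective x x y (trans (dist-self x) (sym dxy≡0))))
    where
    dxy≡0 : dist x y ≡ 0
    dxy≡0 = m+n≡0⇒m≡0 (dist x y) (trans (sym (dist-add x y x no-wrap)) (dist-self x))
  ... | no wraps = ≤-antisym (m∸n≡0⇒m≤n excess≡0) L≤s
    where
    s : ℕ
    s = dist x y + dist y x
    L≤s : L ≤ s
    L≤s = ≮⇒≥ wraps
    excess<L : s ∸ L < L
    excess<L = +-cancelʳ-< L (s ∸ L) L (subst (_< L + L) (sym (m∸n+n≡m L≤s))
                 (+-mono-< (dist<len x y) (dist<len y x)))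
    excess≡0 : s ∸ L ≡ 0
    excess≡0 = trans (sym (dist-unique x x (s ∸ L) excess<L (begin
      (s ∸ L + toℕ x) % L       ≡⟨ [m+n]%n≡m%n (s ∸ L + toℕ x) L ⟨
      (s ∸ L + toℕ x + L) % L   ≡⟨ cong (_% L) (xy∙z≈xz∙y (s ∸ L) (toℕ x) L) ⟩
      (s ∸ L + L + toℕ x) % L   ≡⟨ cong (λ t → (t + toℕ x) % L) (m∸n+n≡m L≤s) ⟩
      (s + toℕ x) % L           ≡⟨ dist-compose x y x ⟩
      toℕ x                     ∎))) (dist-self x)

  _⊕_ : Fin L → ℕ → Fin L
  p ⊕ zero  = p
  p ⊕ suc t = succ (p ⊕ t)

  dist-⊕ : (p : Fin L) (t : ℕ) → t < L → dist p (p ⊕ t) ≡ t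
  dist-⊕ p zero    _  = dist-self p
  dist-⊕ p (suc t) lt = begin
    dist p (succ (p ⊕ t))  ≡⟨ dist-succ p (p ⊕ t) (subst (λ d → suc d < L) (sym ih) lt) ⟩
    suc (dist p (p ⊕ t))   ≡⟨ cong suc ih ⟩
    suc t                  ∎
    where
    ih : dist p (p ⊕ t) ≡ t
    ih = dist-⊕ p t (<-trans (n<1+n t) lt)

  ⊕-dist : (p i : Fin L) → p ⊕ dist p i ≡ i
  ⊕-dist p i = dist-injective p (p ⊕ dist p i) i (dist-⊕ p (dist p i) (dist<len p i))

  arcs-disjoint : (x y z : Fin L) → x ≢ y → dist x z < dist x y → dist y z < dist y x → ⊥
  arcs-disjoint x y z x≢y zx< zy< =
    <⇒≱ zx< (subst (dist x y ≤_) (sym (dist-add x y z no-wrap)) (m≤m+n (dist x y) (dist y z)))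
    where
    no-wrap : dist x y + dist y z < L
    no-wrap = subst (dist x y + dist y z <_) (dist-round-trip x y x≢y) (+-monoʳ-< (dist x y) zy<)

even⊎odd : ∀ n → Even n ⊎ Odd n
even⊎odd n with n % 2 | m%n<n n 2
... | 0           | _ = inj₁ refl
... | 1           | _ = inj₂ refl
... | suc (suc _) | s≤s (s≤s ())

even-suc : ∀ n → Even n → Odd (suc n)
even-suc n even = trans (sym (%-absorbʳ 1 n 2)) (cong (λ r → suc r % 2) even)

odd-suc : ∀ n → Odd n → Even (suc n)
odd-suc n odd = trans (sym (%-absorbʳ 1 n 2)) (cong (λ r → suc r % 2) odd)

even+odd : ∀ m n → Even m → Odd n → Odd (m + n)
even+odd m n even odd = trans (%-distribˡ-+ m n 2) (cong₂ (λ r s → (r + s) % 2) even odd)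

even-odd-exclusive : ∀ n → Even n → Odd n → ⊥
even-odd-exclusive n even odd with trans (sym even) odd
... | ()

-- A position at even offset from every mark lies strictly inside every odd path
-- between consecutive marks: otherwise the path would end before it, and the
-- offset from the path's start would be odd.
evenPoint-inside-oddPath : ∀ {k} (p : Fin 4 → Fin (suc k)) (i₀ : Fin (suc k)) →
  (∀ a → Even (dist (p a) i₀)) →
  ∀ a → OddPathFrom p a → ∀ b → p b ≢ p a → dist (p a) i₀ < dist (p a) (p b)
evenPoint-inside-oddPath p i₀ even a (c , _ , nearest , odd) b pb≢pa
  with dist (p a) (p c) ≤? dist (p a) i₀
... | yes reaches = ⊥-elim (even-odd-exclusive (dist (p a) i₀) (even a)
                      (subst Odd (m∸n+n≡m reaches) (even+odd rest (dist (p a) (p c)) evenRest odd)))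
  where
  rest : ℕ
  rest = dist (p a) i₀ ∸ dist (p a) (p c)
  evenRest : Even rest
  evenRest = subst Even (dist-sub (p a) (p c) i₀ reaches) (even c)
... | no ¬reaches = <-≤-trans (≰⇒> ¬reaches) (nearest b pb≢pa)

-- Consequently, if some position is at even offset from all marks, two
-- distinct marks cannot both start odd paths: the position would lie on both.
evenPoint-forbids-two-oddPaths : ∀ {k} (p : Fin 4 → Fin (suc k)) (i₀ : Fin (suc k)) →
  (∀ a → Even (dist (p a) i₀)) →
  ∀ a b → p a ≢ p b → OddPathFrom p a → OddPathFrom p b → ⊥
evenPoint-forbids-two-oddPaths p i₀ even a b pa≢pb oddA oddB =
  arcs-disjoint (p a) (p b) i₀ pa≢pb
    (evenPoint-inside-oddPath p i₀ even a oddA b (≢-sym pa≢pb))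
    (evenPoint-inside-oddPath p i₀ even b oddB a pa≢pb)

Least : (ℕ → Set) → Set
Least P = ∃[ j ] (P j × (∀ {i} → i < j → ¬ P i))

least : {P : ℕ → Set} → (∀ n → Dec (P n)) → ∀ n → P n → Least P
least {P} P? = <-rec (λ n → P n → Least P) search
  where
  search : ∀ n → (∀ {m} → m < n → P m → Least P) → P n → Least P
  search n below Pn with anyUpTo? P? n
  ... | yes (m , m<n , Pm) = below m<n Pm
  ... | no none            = n , Pn , λ i<n Pi → none (_ , i<n , Pi)

module Endpoints (G : Graph) where
  open Graph G

  joins-inc₁ : ∀ {e u w} → Joins G e u w → Incident G u e
  joins-inc₁ (inj₁ eq) = inj₁ (cong proj₁ eq)
  joins-inc₁ (inj₂ eq) = inj₂ (cong proj₂ eq)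

  joins-inc₂ : ∀ {e u w} → Joins G e u w → Incident G w e
  joins-inc₂ (inj₁ eq) = inj₂ (cong proj₂ eq)
  joins-inc₂ (inj₂ eq) = inj₁ (cong proj₁ eq)

  joins-sym : ∀ {e u w} → Joins G e u w → Joins G e w u
  joins-sym (inj₁ eq) = inj₂ eq
  joins-sym (inj₂ eq) = inj₁ eq

  ¬loop : ∀ {e u} → ¬ Joins G e u u
  ¬loop {e} (inj₁ eq) = loopless e (trans (cong proj₁ eq) (sym (cong proj₂ eq)))
  ¬loop {e} (inj₂ eq) = loopless e (trans (cong proj₁ eq) (sym (cong proj₂ eq)))

  far-end : ∀ {e u w y z} → Joins G e u w → Joins G e y z → (z ≡ u) ⊎ (z ≡ w)
  far-end (inj₁ p) (inj₁ q) = inj₂ (trans (sym (cong proj₂ q)) (cong proj₂ p))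
  far-end (inj₁ p) (inj₂ q) = inj₁ (trans (sym (cong proj₁ q)) (cong proj₁ p))
  far-end (inj₂ p) (inj₁ q) = inj₁ (trans (sym (cong proj₂ q)) (cong proj₂ p))
  far-end (inj₂ p) (inj₂ q) = inj₂ (trans (sym (cong proj₁ q)) (cong proj₁ p))

  joins-right : ∀ {e u w z} → Joins G e u w → Joins G e u z → z ≡ w
  joins-right {e} {u} j j′ with far-end j j′
  ... | inj₂ z≡w = z≡w
  ... | inj₁ z≡u = ⊥-elim (¬loop (subst (Joins G e u) z≡u j′))

  joins-left : ∀ {e u w y} → Joins G e u w → Joins G e y w → y ≡ u
  joins-left j j′ = joins-right (joins-sym j) (joins-sym j′)

  other : Edge G → Vertex G → Vertex G
  other e v with proj₁ (ends e) ≟ᶠ v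
  ... | yes _ = proj₂ (ends e)
  ... | no _  = proj₁ (ends e)

  incident-joins : ∀ {v e} → Incident G v e → Joins G e v (other e v)
  incident-joins {v} {e} inc with proj₁ (ends e) ≟ᶠ v
  incident-joins {v} {e} inc        | yes first≡v = inj₁ (cong₂ _,_ first≡v refl)
  incident-joins {v} {e} (inj₁ eq)  | no first≢v  = ⊥-elim (first≢v eq)
  incident-joins {v} {e} (inj₂ eq)  | no _        = inj₂ (cong₂ _,_ refl eq)

module Complement (G : Graph) (cubic : Cubic G) (M : EdgeSet G) (pm : IsPerfectMatching G M) where
  open Endpoints G

  μ : Vertex G → Edge G
  μ v = proj₁ (pm v)

  μ∈M : ∀ v → μ v ∈ M
  μ∈M v = proj₁ (proj₂ (pm v))

  μ-inc : ∀ v → Incident G v (μ v)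
  μ-inc v = proj₁ (proj₂ (proj₂ (pm v)))

  μ-unique : ∀ v f → f ∈ M → Incident G v f → f ≡ μ v
  μ-unique v = proj₂ (proj₂ (proj₂ (pm v)))

  record Spokes (v : Vertex G) : Set where
    field
      s₁ s₂  : Edge G
      inc₁   : Incident G v s₁
      inc₂   : Incident G v s₂
      s₁∉M   : s₁ ∉ M
      s₂∉M   : s₂ ∉ M
      s₁≢s₂  : s₁ ≢ s₂
      only   : ∀ f → Incident G v f → f ∉ M → (f ≡ s₁) ⊎ (f ≡ s₂)

  spokes-besides : ∀ {v} a b c → Incident G v a → Incident G v b → a ≢ b → a ≢ c → b ≢ c →
    μ v ≡ c → (∀ f → Incident G v f → f ≢ c → (f ≡ a) ⊎ (f ≡ b)) → Spokes v
  spokes-besides {v} a b c inc-a inc-b a≢b a≢c b≢c μ≡c rest = record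
    { s₁ = a ; s₂ = b ; inc₁ = inc-a ; inc₂ = inc-b
    ; s₁∉M = λ a∈M → a≢c (trans (μ-unique v a a∈M inc-a) μ≡c)
    ; s₂∉M = λ b∈M → b≢c (trans (μ-unique v b b∈M inc-b) μ≡c)
    ; s₁≢s₂ = a≢b
    ; only = λ f inc f∉M → rest f inc (λ f≡c → f∉M (subst (_∈ M) (trans μ≡c (sym f≡c)) (μ∈M v)))
    }

  spokes : ∀ v → Spokes v
  spokes v with cubic v
  ... | e₁ , e₂ , e₃ , i₁ , i₂ , i₃ , d₁₂ , d₁₃ , d₂₃ , only with only (μ v) (μ-inc v)
  ... | inj₁ μ≡e₁ = spokes-besides e₂ e₃ e₁ i₂ i₃ d₂₃ (≢-sym d₁₂) (≢-sym d₁₃) μ≡e₁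
        (λ f inc f≢e₁ → [ (λ q → ⊥-elim (f≢e₁ q)) , id ] (only f inc))
  ... | inj₂ (inj₁ μ≡e₂) = spokes-besides e₁ e₃ e₂ i₁ i₃ d₁₃ d₁₂ (≢-sym d₂₃) μ≡e₂
        (λ f inc f≢e₂ → [ inj₁ , [ (λ q → ⊥-elim (f≢e₂ q)) , inj₂ ] ] (only f inc))
  ... | inj₂ (inj₂ μ≡e₃) = spokes-besides e₁ e₂ e₃ i₁ i₂ d₁₂ d₁₃ d₂₃ μ≡e₃
        (λ f inc f≢e₃ → [ inj₁ , [ inj₂ , (λ q → ⊥-elim (f≢e₃ q)) ] ] (only f inc))

  module _ {v : Vertex G} where
    open Spokes (spokes v)

    both-spokes : ∀ {g h f} → Incident G v g → Incident G v h → g ∉ M → h ∉ M → g ≢ h →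
      Incident G v f → f ∉ M → (f ≡ g) ⊎ (f ≡ h)
    both-spokes {g} {h} {f} inc-g inc-h g∉M h∉M g≢h inc-f f∉M
      with only g inc-g g∉M | only h inc-h h∉M | only f inc-f f∉M
    ... | inj₁ g≡ | inj₁ h≡ | _       = ⊥-elim (g≢h (trans g≡ (sym h≡)))
    ... | inj₂ g≡ | inj₂ h≡ | _       = ⊥-elim (g≢h (trans g≡ (sym h≡)))
    ... | inj₁ g≡ | inj₂ _  | inj₁ f≡ = inj₁ (trans f≡ (sym g≡))
    ... | inj₁ _  | inj₂ h≡ | inj₂ f≡ = inj₂ (trans f≡ (sym h≡))
    ... | inj₂ _  | inj₁ h≡ | inj₁ f≡ = inj₂ (trans f≡ (sym h≡))
    ... | inj₂ g≡ | inj₁ _  | inj₂ f≡ = inj₁ (trans f≡ (sym g≡))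

  module _ (v : Vertex G) where
    open Spokes (spokes v)

    turn : Edge G → Edge G
    turn e with s₁ ≟ᶠ e
    ... | yes _ = s₂
    ... | no _  = s₁

    turn-spec : ∀ e → Incident G v (turn e) × turn e ∉ M × turn e ≢ e
    turn-spec e with s₁ ≟ᶠ e
    ... | yes s₁≡e = inc₂ , s₂∉M , λ s₂≡e → s₁≢s₂ (trans s₁≡e (sym s₂≡e))
    ... | no s₁≢e  = inc₁ , s₁∉M , s₁≢e

  OnCycle : CycleOf G M → Vertex G → Set
  OnCycle C y = ∃[ i ] (CycleOf.vtx C i ≡ y)

  module CycleFacts (C : CycleOf G M) where
    open CycleOf C

    succ≢ : ∀ j → succ j ≢ j
    succ≢ j eq = ¬loop (subst (Joins G (edg j) (vtx j)) (cong vtx eq) (joins j))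

    predecessor : ∀ i → ∃[ j ] (succ j ≡ i)
    predecessor i with dist (succ i) i | ⊕-dist (succ i) i
    ... | zero  | back = ⊥-elim (succ≢ i back)
    ... | suc t | back = succ i ⊕ t , back

    edges-at-succ : ∀ j f → Incident G (vtx (succ j)) f → f ∉ M → (f ≡ edg j) ⊎ (f ≡ edg (succ j))
    edges-at-succ j f = both-spokes (joins-inc₂ (joins j)) (joins-inc₁ (joins (succ j)))
                          (edg∉M j) (edg∉M (succ j)) (λ eq → succ≢ j (sym (edg-inj eq)))

    edges-at : ∀ i f → Incident G (vtx i) f → f ∉ M → ∃[ j ] (edg j ≡ f)
    edges-at i f inc f∉M with predecessor i
    ... | j , refl with edges-at-succ j f inc f∉M
    ...   | inj₁ f≡ = j , sym f≡
    ...   | inj₂ f≡ = succ j , sym f≡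

    cycle-closed : ∀ {y z f} → OnCycle C y → f ∉ M → Joins G f y z → OnCycle C z
    cycle-closed {f = f} (i , refl) f∉M yz with edges-at i f (joins-inc₁ yz) f∉M
    ... | j , refl with far-end (joins j) yz
    ...   | inj₁ z≡ = j , sym z≡
    ...   | inj₂ z≡ = succ j , sym z≡

    cycle-absorbs : (D : CycleOf G M) → ∀ j → OnCycle C (CycleOf.vtx D j) →
      ∀ j′ → OnCycle C (CycleOf.vtx D j′)
    cycle-absorbs D j on j′ = subst (λ i → OnCycle C (CycleOf.vtx D i)) (⊕-dist j j′) (reach (dist j j′))
      where
      reach : ∀ t → OnCycle C (CycleOf.vtx D (j ⊕ t))
      reach zero    = on
      reach (suc t) = cycle-closed (reach t) (CycleOf.edg∉M D (j ⊕ t)) (CycleOf.joins D (j ⊕ t))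

    -- A perfect matching N that avoids edg p and, at every vertex of C except
    -- vtx p, uses an edge outside M (hence an edge of C) alternates along C
    -- starting at p: the edges of C outside N are those at even offset from p.
    module Alternation (N : EdgeSet G) (pmN : IsPerfectMatching G N) (p : Fin (suc k))
                       (edg-p∉N : edg p ∉ N)
                       (off-M : ∀ j → j ≢ p → ∀ g → g ∈ N → Incident G (vtx j) g → g ∉ M) where

      alternates : ∀ j → succ j ≢ p → (edg j ∈ N → edg (succ j) ∉ N) × (edg j ∉ N → edg (succ j) ∈ N)
      alternates j succ≢p = both-not-in , one-in
        where
        v : Vertex G
        v = vtx (succ j)
        n : Edge G
        n = proj₁ (pmN v)
        n∈N : n ∈ N
        n∈N = proj₁ (proj₂ (pmN v))
        n-inc : Incident G v n
        n-inc = proj₁ (proj₂ (proj₂ (pmN v)))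
        n-unique : ∀ f → f ∈ N → Incident G v f → f ≡ n
        n-unique = proj₂ (proj₂ (proj₂ (pmN v)))
        inc-j : Incident G v (edg j)
        inc-j = joins-inc₂ (joins j)
        inc-sj : Incident G v (edg (succ j))
        inc-sj = joins-inc₁ (joins (succ j))
        both-not-in : edg j ∈ N → edg (succ j) ∉ N
        both-not-in in₁ in₂ =
          succ≢ j (sym (edg-inj (trans (n-unique (edg j) in₁ inc-j) (sym (n-unique (edg (succ j)) in₂ inc-sj)))))
        one-in : edg j ∉ N → edg (succ j) ∈ N
        one-in out with edges-at-succ j n n-inc (off-M (succ j) succ≢p n n∈N n-inc)
        ... | inj₁ n≡ = ⊥-elim (out (subst (_∈ N) n≡ n∈N))
        ... | inj₂ n≡ = subst (_∈ N) n≡ n∈N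

      moved : ∀ t → suc t < suc k → p ⊕ suc t ≢ p
      moved t lt back = 0≢1+n (trans (sym (dist-self p)) (trans (cong (dist p) (sym back)) (dist-⊕ p (suc t) lt)))

      phase : ∀ t → t < suc k → (edg (p ⊕ t) ∈ N × Odd t) ⊎ (edg (p ⊕ t) ∉ N × Even t)
      phase zero    _  = inj₂ (edg-p∉N , refl)
      phase (suc t) lt with phase t (<-trans (n<1+n t) lt)
      ... | inj₁ (in-N , odd)   = inj₂ (proj₁ (alternates (p ⊕ t) (moved t lt)) in-N , odd-suc t odd)
      ... | inj₂ (out-N , even) = inj₁ (proj₂ (alternates (p ⊕ t) (moved t lt)) out-N , even-suc t even)

      even-outside : ∀ i → edg i ∉ N → Even (dist p i)
      even-outside i i∉N with phase (dist p i) (dist<len p i) | ⊕-dist p i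
      ... | inj₁ (in-N , _) | back = ⊥-elim (i∉N (subst (λ j → edg j ∈ N) back in-N))
      ... | inj₂ (_ , even) | _    = even

    balanced-alternation : ∀ A (bal : IsBalanced G M A) p → Touches G A (vtx p) →
      (∀ j → Touches G A (vtx j) → j ≡ p) → ∀ i → edg i ∉ proj₁ bal → Even (dist p i)
    balanced-alternation A (M′ , pmM′ , spec) p (t , t∈A , t-inc) touches-only-p =
      Alternation.even-outside M′ pmM′ p edg-p∉M′ off-M
      where
      unique′ : ∀ f → f ∈ M′ → Incident G (vtx p) f → f ≡ proj₁ (pmM′ (vtx p))
      unique′ = proj₂ (proj₂ (proj₂ (pmM′ (vtx p))))
      edg-p∉M′ : edg p ∉ M′
      edg-p∉M′ in-M′ = edg∉M p (subst (_∈ M) t≡edg (proj₁ (proj₁ (spec t) t∈A)))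
        where
        t≡edg : t ≡ edg p
        t≡edg = trans (unique′ t (proj₂ (proj₁ (spec t) t∈A)) t-inc)
                      (sym (unique′ (edg p) in-M′ (joins-inc₁ (joins p))))
      off-M : ∀ j → j ≢ p → ∀ g → g ∈ M′ → Incident G (vtx j) g → g ∉ M
      off-M j j≢p g g∈M′ g-inc g∈M = j≢p (touches-only-p j (g , proj₂ (spec g) (g∈M , g∈M′) , g-inc))

  -- Every vertex v₀ lies on a cycle of G ∖ M: walk from v₀ along G ∖ M, leaving
  -- each vertex by the spoke it was not entered by, until the first time a
  -- vertex repeats; the repeated vertex is necessarily v₀ itself.
  module CycleThrough (v₀ : Vertex G) where
    advance : Vertex G × Edge G → Vertex G × Edge G
    advance (y , e) = other e y , turn (other e y) e

    walk : ℕ → Vertex G × Edge G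
    walk zero    = v₀ , Spokes.s₁ (spokes v₀)
    walk (suc t) = advance (walk t)

    x : ℕ → Vertex G
    x t = proj₁ (walk t)

    ε : ℕ → Edge G
    ε t = proj₂ (walk t)

    departs : ∀ t → Incident G (x t) (ε t) × ε t ∉ M
    departs zero    = Spokes.inc₁ (spokes v₀) , Spokes.s₁∉M (spokes v₀)
    departs (suc t) = proj₁ (turn-spec (x (suc t)) (ε t)) , proj₁ (proj₂ (turn-spec (x (suc t)) (ε t)))

    steps : ∀ t → Joins G (ε t) (x t) (x (suc t))
    steps t = incident-joins (proj₁ (departs t))

    turns : ∀ t → ε (suc t) ≢ ε t
    turns t = proj₂ (proj₂ (turn-spec (x (suc t)) (ε t)))

    arrives : ∀ t f → Incident G (x (suc t)) f → f ∉ M → (f ≡ ε t) ⊎ (f ≡ ε (suc t))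
    arrives t f = both-spokes (joins-inc₂ (steps t)) (proj₁ (departs (suc t)))
                    (proj₂ (departs t)) (proj₂ (departs (suc t))) (≢-sym (turns t))

    Repeats : ℕ → Set
    Repeats j = ∃[ i ] (i < j × x i ≡ x j)

    repeats? : ∀ j → Dec (Repeats j)
    repeats? j = anyUpTo? (λ i → x i ≟ᶠ x j) j

    repeats-late : ∀ j → Repeats j → ∃[ j′ ] Repeats (suc j′)
    repeats-late zero    (_ , () , _)
    repeats-late (suc j) r = j , r

    first-repeat : Least (Repeats ∘ suc)
    first-repeat with pigeonhole (n<1+n (Graph.n G)) (λ i → x (toℕ i))
    ... | i , j , i<j , same with repeats-late (toℕ j) (toℕ i , i<j , same)
    ...   | j′ , r = least (λ j → repeats? (suc j)) j′ r

    K : ℕ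
    K = proj₁ first-repeat

    distinct : ∀ {a b} → a < b → b < suc K → x a ≢ x b
    distinct {a} {suc b} a<b b<K eq = proj₂ (proj₂ first-repeat) (≤-pred b<K) (a , a<b , eq)

    starts-repeat : ∀ i → i < suc K → x i ≡ x (suc K) → i ≡ 0
    starts-repeat zero    _  _  = refl
    starts-repeat (suc i) lt eq
      with arrives i (ε K) (subst (λ y → Incident G y (ε K)) (sym eq) (joins-inc₂ (steps K))) (proj₂ (departs K))
    ... | inj₁ εK≡εi = ⊥-elim (distinct (≤-pred lt) (n<1+n K) (sym (joins-left (steps i) arrival)))
      where
      arrival : Joins G (ε i) (x K) (x (suc i))
      arrival = subst₂ (λ e y → Joins G e (x K) y) εK≡εi (sym eq) (steps K)
    ... | inj₂ εK≡εsi with <-cmp (suc (suc i)) K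
    ...   | tri< lt′ _ _ = ⊥-elim (distinct lt′ (n<1+n K) (sym xK≡))
      where
      xK≡ : x K ≡ x (suc (suc i))
      xK≡ = joins-right (steps (suc i)) (joins-sym (subst₂ (λ e y → Joins G e (x K) y) εK≡εsi (sym eq) (steps K)))
    ...   | tri≈ _ ssi≡K _ = ⊥-elim (turns (suc i) (trans (cong ε ssi≡K) εK≡εsi))
    ...   | tri> _ _ K<ssi = ⊥-elim (¬loop (subst (Joins G (ε K) (x K)) back (steps K)))
      where
      back : x (suc K) ≡ x K
      back = trans (sym eq) (cong x (≤-antisym (≤-pred lt) (≤-pred K<ssi)))

    returns : x (suc K) ≡ x 0
    returns with proj₁ (proj₂ first-repeat)
    ... | i , i<sK , eq = trans (sym eq) (cong x (starts-repeat i i<sK eq))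

    ε-distinct : ∀ {a b} → a < b → b < suc K → ε a ≢ ε b
    ε-distinct {a} {b} a<b b<sK eq
      with far-end (steps a) (joins-sym (subst (λ e → Joins G e (x b) (x (suc b))) (sym eq) (steps b)))
    ... | inj₁ xb≡xa  = distinct a<b b<sK (sym xb≡xa)
    ... | inj₂ xb≡xsa with <-cmp (suc a) b
    ...   | tri< sa<b _ _ = distinct sa<b b<sK (sym xb≡xsa)
    ...   | tri≈ _ sa≡b _ = turns a (trans (cong ε sa≡b) (sym eq))
    ...   | tri> _ _ b<sa = <-irrefl refl (<-≤-trans a<b (≤-pred b<sa))

    injective-below : {A : Set} (h : ℕ → A) → (∀ {a b} → a < b → b < suc K → h a ≢ h b) →
      Injective _≡_ _≡_ (λ (i : Fin (suc K)) → h (toℕ i))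
    injective-below h apart {i} {j} eq with <-cmp (toℕ i) (toℕ j)
    ... | tri< lt _ _   = ⊥-elim (apart lt (toℕ<n j) eq)
    ... | tri≈ _ same _ = toℕ-injective same
    ... | tri> _ _ gt   = ⊥-elim (apart gt (toℕ<n i) (sym eq))

    x-succ : ∀ (i : Fin (suc K)) → x (suc (toℕ i)) ≡ x (toℕ (succ i))
    x-succ i with suc (toℕ i) <? suc K
    ... | yes lt = cong x (sym (trans (toℕ-fromℕ< (m%n<n (suc (toℕ i)) (suc K))) (m<n⇒m%n≡m lt)))
    ... | no ¬lt = trans (cong x last) (trans returns (cong x (sym wraps)))
      where
      last : suc (toℕ i) ≡ suc K
      last = ≤-antisym (toℕ<n i) (≮⇒≥ ¬lt)
      wraps : toℕ (succ i) ≡ 0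
      wraps = trans (toℕ-fromℕ< (m%n<n (suc (toℕ i)) (suc K))) (trans (cong (_% suc K) last) (n%n≡0 (suc K)))

    cycle : CycleOf G M
    cycle = record
      { k       = K
      ; vtx     = λ i → x (toℕ i)
      ; edg     = λ i → ε (toℕ i)
      ; vtx-inj = injective-below x distinct
      ; edg-inj = injective-below ε ε-distinct
      ; edg∉M   = λ i → proj₂ (departs (toℕ i))
      ; joins   = λ i → subst (Joins G (ε (toℕ i)) (x (toℕ i))) (x-succ i) (steps (toℕ i))
      }

  -- the cycle of G ∖ M through v, with v at position zero; it is kept opaque
  -- so that its vertex and edge functions are never unfolded
  opaque
    cycleAt : Vertex G → CycleOf G M
    cycleAt = CycleThrough.cycle

    cycleAt-start : ∀ v → CycleOf.vtx (cycleAt v) 0F ≡ v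
    cycleAt-start v = refl

firstTrue : ∀ {n} → (Fin n → Bool) → Maybe (Fin n)
firstTrue {zero}  t = nothing
firstTrue {suc n} t = if t zero then just zero else mapᵐ suc (firstTrue (t ∘ suc))

firstTrue-cong : ∀ {n} {t t′ : Fin n → Bool} → t ≗ t′ → firstTrue t ≡ firstTrue t′
firstTrue-cong {zero}  same = refl
firstTrue-cong {suc n} same =
  cong₂ (λ b m → if b then just zero else mapᵐ suc m) (same zero) (firstTrue-cong (same ∘ suc))

firstTrue-sound : ∀ {n} (t : Fin n → Bool) {c} → firstTrue t ≡ just c → t c ≡ true
firstTrue-sound {suc n} t found with t zero in t0
... | true  with found
...   | refl = t0
firstTrue-sound {suc n} t found | false with firstTrue (t ∘ suc) in rest | found
... | just c | refl = firstTrue-sound (t ∘ suc) rest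

firstTrue-complete : ∀ {n} (t : Fin n → Bool) a → t a ≡ true → ∃[ c ] (firstTrue t ≡ just c)
firstTrue-complete {suc n} t a ta with t zero in t0
... | true = zero , refl
firstTrue-complete {suc n} t zero    ta | false with trans (sym ta) t0
... | ()
firstTrue-complete {suc n} t (suc a) ta | false with firstTrue-complete (t ∘ suc) a ta
... | c , found = suc c , cong (mapᵐ suc) found

-- The role of a colour a on a cycle, given which colours are absent from the
-- cycle: `just c` says that on this cycle the new matching for a replaces the
-- edges of colour a by the complement of those of the first absent colour c.
role : ∀ {n} → (Fin n → Bool) → Fin n → Maybe (Fin n)
role absent a = roleFrom (firstTrue absent) (absent a)
  where
  roleFrom : Maybe _ → Bool → Maybe _
  roleFrom (just c) true = if does (c ≟ᶠ a) then nothing else just c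
  roleFrom _        _    = nothing

role-just : ∀ {n} (t : Fin n → Bool) a {c} → role t a ≡ just c → t c ≡ true × t a ≡ true
role-just t a r with firstTrue t in ft | t a in ta
role-just t a r    | just c  | true with c ≟ᶠ a
role-just t a ()   | just c  | true | yes _
role-just t a refl | just c  | true | no _ = firstTrue-sound t ft , refl
role-just t a ()   | just c  | false
role-just t a ()   | nothing | _

role-first : ∀ {n} (t : Fin n → Bool) {c} → firstTrue t ≡ just c → role t c ≡ nothing
role-first t {c} ft with firstTrue t | t c
role-first t {c} refl | just c | true with c ≟ᶠ c
... | yes _  = refl
... | no c≢c = ⊥-elim (c≢c refl)
role-first t {c} refl | just c | false = refl

role-second : ∀ {n} (t : Fin n → Bool) {c d} → firstTrue t ≡ just c → c ≢ d → t d ≡ true →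
  role t d ≡ just c
role-second t {c} {d} ft c≢d td with firstTrue t | t d
role-second t {c} {d} refl c≢d refl | just c | true with c ≟ᶠ d
... | yes c≡d = ⊥-elim (c≢d c≡d)
... | no _    = refl

role-present : ∀ {n} (t : Fin n → Bool) a → t a ≡ false → role t a ≡ nothing
role-present t a ta with firstTrue t | t a
role-present t a refl | just _  | false = refl
role-present t a refl | nothing | false = refl

role-cong : ∀ {n} {t t′ : Fin n → Bool} → t ≗ t′ → ∀ a → role t a ≡ role t′ a
role-cong {t = t} {t′} same a with firstTrue t | firstTrue t′ | firstTrue-cong same | t a | t′ a | same a
... | f | .f | refl | b | .b | refl = refl

from-does : ∀ {A : Set} (a? : Dec A) → does a? ≡ true → A
from-does (yes a) _ = a
from-does (no _) ()

Matched : (G : Graph) → EdgeSet G → Vertex G → Set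
Matched G S v = ∃[ e ] (e ∈ S × Incident G v e × (∀ f → f ∈ S → Incident G v f → f ≡ e))

matched-transfer : ∀ {G S P v} → (∀ e → Incident G v e → e ∈ S ⇔ e ∈ P) → Matched G P v → Matched G S v
matched-transfer same (e , e∈P , inc , unique) =
  e , from (same e inc) e∈P , inc , λ f f∈S f-inc → unique f (to (same f f-inc) f∈S) f-inc

⟦_⟧ : ∀ {m} {P : Fin m → Set} → (∀ e → Dec (P e)) → Subset m
⟦ P? ⟧ = tabulate (λ e → does (P? e))

∈⟦⟧ : ∀ {m} {P : Fin m → Set} (P? : ∀ e → Dec (P e)) e → e ∈ ⟦ P? ⟧ ⇔ P e
∈⟦⟧ P? e = mk⇔
  (λ e∈ → from-does (P? e) (trans (sym (lookup∘tabulate (λ e → does (P? e)) e)) ([]=⇒lookup e∈)))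
  (λ Pe → lookup⇒[]= e _ (trans (lookup∘tabulate (λ e → does (P? e)) e) (dec-true (P? e) Pe)))

module Decide (G : Graph) where
  open Graph G

  incident? : ∀ v e → Dec (Incident G v e)
  incident? v e = (proj₁ (ends e) ≟ᶠ v) ⊎-dec (proj₂ (ends e) ≟ᶠ v)

  touches? : ∀ A v → Dec (Touches G A v)
  touches? A v = any? (λ e → (e ∈? A) ×-dec incident? v e)

module Recolouring (G : Graph) (cubic : Cubic G) (M : EdgeSet G) (pm : IsPerfectMatching G M)
                   {n : ℕ} (X : Fin n → EdgeSet G) (bal : ∀ a → IsBalanced G M (X a)) where
  open Endpoints G
  open Complement G cubic M pm
  open Decide G

  Mx : Fin n → EdgeSet G
  Mx a = proj₁ (bal a)

  pmx : ∀ a → IsPerfectMatching G (Mx a)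
  pmx a = proj₁ (proj₂ (bal a))

  M∩Mx⊆X : ∀ a e → e ∈ M → e ∈ Mx a → e ∈ X a
  M∩Mx⊆X a e e∈M e∈Mx = proj₂ (proj₂ (proj₂ (bal a)) e) (e∈M , e∈Mx)

  Absent : Fin n → Vertex G → Set
  Absent a v = ¬ (∃[ i ] Touches G (X a) (CycleOf.vtx (cycleAt v) i))

  absent? : ∀ a v → Dec (Absent a v)
  absent? a v = ¬? (any? (λ i → touches? (X a) (CycleOf.vtx (cycleAt v) i)))

  absent-here : ∀ {a v} → Absent a v → ¬ Touches G (X a) v
  absent-here {a} {v} absent touch =
    absent (0F , subst (Touches G (X a)) (sym (cycleAt-start v)) touch)

  absentᵇ : Vertex G → Fin n → Bool
  absentᵇ v a = does (absent? a v)

  -- adjacent vertices of G ∖ M lie on the same cycle, so see the same absent colours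
  absent-moves : ∀ {a v w f} → f ∉ M → Joins G f v w → Absent a v → Absent a w
  absent-moves {a} {v} {w} f∉M vw absent (i , touch) =
    absent (j , subst (Touches G (X a)) (sym same) touch)
    where
    on-v : OnCycle (cycleAt v) (CycleOf.vtx (cycleAt w) i)
    on-v = CycleFacts.cycle-absorbs (cycleAt v) (cycleAt w) 0F
             (subst (OnCycle (cycleAt v)) (sym (cycleAt-start w))
               (CycleFacts.cycle-closed (cycleAt v) (0F , cycleAt-start v) f∉M vw)) i
    j : Fin (suc (CycleOf.k (cycleAt v)))
    j = proj₁ on-v
    same : CycleOf.vtx (cycleAt v) j ≡ CycleOf.vtx (cycleAt w) i
    same = proj₂ on-v

  role-moves : ∀ {v w f} → f ∉ M → Joins G f v w → ∀ a → role (absentᵇ v) a ≡ role (absentᵇ w) a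
  role-moves {v} {w} f∉M vw = role-cong λ b →
    does-⇔ (mk⇔ (absent-moves f∉M vw) (absent-moves f∉M (joins-sym vw))) (absent? b v) (absent? b w)

  -- the role of a colour on the cycle containing the edge e ∉ M, read off at its first end
  edgeRole : Edge G → Fin n → Maybe (Fin n)
  edgeRole e = role (absentᵇ (proj₁ (Graph.ends G e)))

  edgeRole-at : ∀ {v e} → e ∉ M → Incident G v e → ∀ a → edgeRole e a ≡ role (absentᵇ v) a
  edgeRole-at e∉M (inj₁ first≡v) a = cong (λ u → role (absentᵇ u) a) first≡v
  edgeRole-at e∉M (inj₂ second≡v) a = role-moves e∉M (inj₁ (cong₂ _,_ refl second≡v)) a

  ByRole : Maybe (Fin n) → Fin n → Edge G → Set
  ByRole nothing  a e = e ∈ Mx a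
  ByRole (just c) a e = e ∉ Mx c

  byRole? : ∀ r a e → Dec (ByRole r a e)
  byRole? nothing  a e = e ∈? Mx a
  byRole? (just c) a e = ¬? (e ∈? Mx c)

  InN : Fin n → Edge G → Set
  InN a e = (e ∈ M × e ∈ Mx a) ⊎ (e ∉ M × ByRole (edgeRole e a) a e)

  inN? : ∀ a e → Dec (InN a e)
  inN? a e = ((e ∈? M) ×-dec (e ∈? Mx a)) ⊎-dec (¬? (e ∈? M) ×-dec byRole? (edgeRole e a) a e)

  N : Fin n → EdgeSet G
  N a = ⟦ inN? a ⟧

  N-on-M : ∀ {a e} → e ∈ M → e ∈ N a ⇔ e ∈ Mx a
  N-on-M {a} {e} e∈M = mk⇔ (λ e∈N → on (to (∈⟦⟧ (inN? a) e) e∈N))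
                           (λ e∈Mx → from (∈⟦⟧ (inN? a) e) (inj₁ (e∈M , e∈Mx)))
    where
    on : InN a e → e ∈ Mx a
    on (inj₁ (_ , e∈Mx)) = e∈Mx
    on (inj₂ (e∉M , _))  = ⊥-elim (e∉M e∈M)

  N-off-M : ∀ {a v e} → e ∉ M → Incident G v e → e ∈ N a ⇔ ByRole (role (absentᵇ v) a) a e
  N-off-M {a} {v} {e} e∉M inc = mk⇔
    (λ e∈N → subst (λ r → ByRole r a e) (edgeRole-at e∉M inc a) (off (to (∈⟦⟧ (inN? a) e) e∈N)))
    (λ by → from (∈⟦⟧ (inN? a) e)
              (inj₂ (e∉M , subst (λ r → ByRole r a e) (sym (edgeRole-at e∉M inc a)) by)))
    where
    off : InN a e → ByRole (edgeRole e a) a e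
    off (inj₁ (e∈M , _)) = ⊥-elim (e∉M e∈M)
    off (inj₂ (_ , by))  = by

  flipped-matched : ∀ {a c v} → role (absentᵇ v) a ≡ just c → Matched G (N a) v
  flipped-matched {a} {c} {v} r = h , h∈N , h-inc , unique
    where
    absent-c : Absent c v
    absent-c = from-does (absent? c v) (proj₁ (role-just (absentᵇ v) a r))
    absent-a : Absent a v
    absent-a = from-does (absent? a v) (proj₂ (role-just (absentᵇ v) a r))
    g : Edge G
    g = proj₁ (pmx c v)
    g∈Mc : g ∈ Mx c
    g∈Mc = proj₁ (proj₂ (pmx c v))
    g-inc : Incident G v g
    g-inc = proj₁ (proj₂ (proj₂ (pmx c v)))
    g-unique : ∀ f → f ∈ Mx c → Incident G v f → f ≡ g
    g-unique = proj₂ (proj₂ (proj₂ (pmx c v)))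
    g∉M : g ∉ M
    g∉M g∈M = absent-here absent-c (g , M∩Mx⊆X c g g∈M g∈Mc , g-inc)
    h : Edge G
    h = turn v g
    h-inc : Incident G v h
    h-inc = proj₁ (turn-spec v g)
    h∉M : h ∉ M
    h∉M = proj₁ (proj₂ (turn-spec v g))
    h≢g : h ≢ g
    h≢g = proj₂ (proj₂ (turn-spec v g))
    off-M : ∀ {f} → f ∉ M → Incident G v f → f ∈ N a ⇔ f ∉ Mx c
    off-M {f} f∉M f-inc = subst (λ r′ → f ∈ N a ⇔ ByRole r′ a f) r (N-off-M f∉M f-inc)
    h∈N : h ∈ N a
    h∈N = from (off-M h∉M h-inc) (λ h∈Mc → h≢g (g-unique h h∈Mc h-inc))
    unique : ∀ f → f ∈ N a → Incident G v f → f ≡ h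
    unique f f∈N f-inc with f ∈? M
    ... | yes f∈M = ⊥-elim (absent-here absent-a (f , M∩Mx⊆X a f f∈M (to (N-on-M f∈M) f∈N) , f-inc))
    ... | no f∉M with both-spokes g-inc h-inc g∉M h∉M (≢-sym h≢g) f-inc f∉M
    ...   | inj₁ f≡g = ⊥-elim (to (off-M f∉M f-inc) f∈N (subst (_∈ Mx c) (sym f≡g) g∈Mc))
    ...   | inj₂ f≡h = f≡h

  N-perfect : ∀ a → IsPerfectMatching G (N a)
  N-perfect a v with role (absentᵇ v) a in r
  ... | nothing = matched-transfer {G} agree (pmx a v)
    where
    agree : ∀ e → Incident G v e → e ∈ N a ⇔ e ∈ Mx a
    agree e inc with e ∈? M
    ... | yes e∈M = N-on-M e∈M
    ... | no e∉M  = subst (λ r′ → e ∈ N a ⇔ ByRole r′ a e) r (N-off-M e∉M inc)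
  ... | just c = flipped-matched r

  kept-covered : ∀ {a v e} → e ∉ M → Incident G v e → role (absentᵇ v) a ≡ nothing → e ∈ Mx a → e ∈ N a
  kept-covered {a} {v} {e} e∉M inc r e∈Mx =
    from (N-off-M e∉M inc) (subst (λ r′ → ByRole r′ a e) (sym r) e∈Mx)

  flipped-covered : ∀ {a c v e} → e ∉ M → Incident G v e → role (absentᵇ v) a ≡ just c →
    e ∉ Mx c → e ∈ N a
  flipped-covered {a} {c} {v} {e} e∉M inc r e∉Mc =
    from (N-off-M e∉M inc) (subst (λ r′ → ByRole r′ a e) (sym r) e∉Mc)

  present-covered : ∀ {a v e} → e ∉ M → Incident G v e → ¬ Absent a v → e ∈ Mx a → e ∈ N a
  present-covered {a} {v} e∉M inc present =
    kept-covered e∉M inc (role-present (absentᵇ v) a (dec-false (absent? a v) present))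

  -- on a cycle from which two colours are absent every edge is covered: by N c
  -- (c the first absent colour) if it lies in M c, and otherwise by N d for an
  -- absent colour d ≠ c
  covered-by-absent-pair : ∀ {v e a b} → e ∉ M → Incident G v e → Absent a v → Absent b v → a ≢ b →
    ∃[ d ] (e ∈ N d)
  covered-by-absent-pair {v} {e} {a} {b} e∉M inc absent-a absent-b a≢b
    with firstTrue-complete (absentᵇ v) a (dec-true (absent? a v) absent-a)
  ... | c , first with e ∈? Mx c | c ≟ᶠ a
  ...   | yes e∈Mc | _       = c , kept-covered e∉M inc (role-first (absentᵇ v) first) e∈Mc
  ...   | no e∉Mc  | yes c≡a = b , flipped-covered e∉M inc
          (role-second (absentᵇ v) first (λ c≡b → a≢b (trans (sym c≡a) c≡b))
            (dec-true (absent? b v) absent-b)) e∉Mc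
  ...   | no e∉Mc  | no c≢a  = a , flipped-covered e∉M inc
          (role-second (absentᵇ v) first c≢a (dec-true (absent? a v) absent-a)) e∉Mc

τ≤-by-cover : ∀ {G n} (M : PerfectMatching G) (F : Fin n → PerfectMatching G) →
  (∀ e → e ∈ proj₁ M ⊎ ∃[ a ] (e ∈ proj₁ (F a))) → τ≤ G (suc n)
τ≤-by-cover {G} {n} M F cover = suc n , ≤-refl , family , covered
  where
  family : Fin (suc n) → PerfectMatching G
  family zero    = M
  family (suc a) = F a
  covered : ∀ e → ∃[ i ] (e ∈ proj₁ (family i))
  covered e = [ (λ e∈M → zero , e∈M) , (λ (a , e∈F) → suc a , e∈F) ]′ (cover e)

module FourColours (G : Graph) (cubic : Cubic G) (M : EdgeSet G) (pm : IsPerfectMatching G M)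
                   (X : Fin 4 → EdgeSet G) (bal : ∀ a → IsBalanced G M (X a))
                   (oddC : OddCycleCondition G M X) (evenC : EvenCycleCondition G M X) where
  open Complement G cubic M pm
  open Recolouring G cubic M pm X bal

  -- On an odd cycle satisfying (i), all four colours are present, hence keep
  -- their matchings; an edge of the cycle in no M a would be at even offset from
  -- all four marks (by alternation), which two odd paths forbid.
  odd-cycle-covered : ∀ {v e} → e ∉ M → Incident G v e →
    (p : Fin 4 → Fin (suc (CycleOf.k (cycleAt v)))) →
    (∀ a → Touches G (X a) (CycleOf.vtx (cycleAt v) (p a)) ×
           (∀ j → Touches G (X a) (CycleOf.vtx (cycleAt v) j) → j ≡ p a)) →
    ∃[ a ] ∃[ b ] (p a ≢ p b × OddPathFrom p a × OddPathFrom p b) → ∃[ a ] (e ∈ N a)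
  odd-cycle-covered {v} {e} e∉M inc p marks (a , b , pa≢pb , odd-a , odd-b) with any? (λ c → e ∈? Mx c)
  ... | yes (c , e∈Mc) = c , present-covered e∉M inc (λ absent → absent (p c , proj₁ (marks c))) e∈Mc
  ... | no in-none = ⊥-elim (evenPoint-forbids-two-oddPaths p i₀ even a b pa≢pb odd-a odd-b)
    where
    open CycleFacts (cycleAt v)
    edge-of-cycle : ∃[ i ] (CycleOf.edg (cycleAt v) i ≡ e)
    edge-of-cycle = edges-at 0F e (subst (λ u → Incident G u e) (sym (cycleAt-start v)) inc) e∉M
    i₀ : Fin (suc (CycleOf.k (cycleAt v)))
    i₀ = proj₁ edge-of-cycle
    even : ∀ c → Even (dist (p c) i₀)
    even c = balanced-alternation (X c) (bal c) (p c) (proj₁ (marks c)) (proj₂ (marks c)) i₀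
               (λ i₀∈Mc → in-none (c , subst (_∈ Mx c) (proj₂ edge-of-cycle) i₀∈Mc))

  edge-covered : ∀ {v e} → e ∉ M → Incident G v e → ∃[ a ] (e ∈ N a)
  edge-covered {v} e∉M inc with even⊎odd (len G (cycleAt v))
  ... | inj₁ even with evenC (cycleAt v) even
  ...   | a , b , a≢b , absent-a , absent-b =
            covered-by-absent-pair e∉M inc (uncurry absent-a) (uncurry absent-b) a≢b
  edge-covered {v} e∉M inc | inj₂ odd with oddC (cycleAt v) odd
  ...   | p , marks , two-odd = odd-cycle-covered e∉M inc p marks two-odd

  covers : ∀ e → e ∈ M ⊎ ∃[ a ] (e ∈ N a)
  covers e with e ∈? M
  ... | yes e∈M = inj₁ e∈M
  ... | no e∉M  = inj₂ (edge-covered e∉M (inj₁ refl))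

theorem5p2 : (G : Graph) → Cubic G → Bridgeless G →
    (M : EdgeSet G) → IsPerfectMatching G M →
    (X : Fin 4 → EdgeSet G) →
    (∀ a → IsBalanced G M (X a)) →
    (∀ a b → a ≢ b → ∀ e → ¬ (e ∈ X a × e ∈ X b)) →
    OddCycleCondition G M X → EvenCycleCondition G M X →
    τ≤ G 5
theorem5p2 G cubic _ M pm X bal _ oddC evenC =
  τ≤-by-cover {G} (M , pm) (λ a → N a , N-perfect a) covers
  where
  open FourColours G cubic M pm X bal oddC evenC using (covers)
  open Recolouring G cubic M pm X bal using (N; N-perfect)
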